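{- Let $p$ be a prime, $m\ge1$ and $\sigma:\mathcal A_m\to\mathcal A_m^*$ a $p$-uniform morphism. For $n\in\mathbb N$ let $R_n(T)$ be the column vector $(P_{\sigma^n(0)}(T),\dots,P_{\sigma^n(m-1)}(T))^{t}$. Then for every $n\in\mathbb N$, $$R_{n+1}(T)=M_\sigma(T^{p^n})R_n(T).$$
   Context: $\mathcal A_m=\{0,\dots,m-1\}$, letters regarded as elements of $\mathbb{F}_p$. For a word $W=w_0\cdots w_{r-1}$, $P_W(T)=\sum_{j=0}^{r-1}w_{r-1-j}T^j\in\mathbb{F}_p[T]$, and $\beta_{W,j}(T)=\sum_{l:\,w_{r-1-l}=j}T^l$ (sum over positions of $j$ in the reversed word; $0$ if $j$ does not occur). $M_\sigma(T)$ is the $m\times m$ matrix over $\mathbb{F}_p[T]$ with $(i,j)$ entry $\beta_{\sigma(i),j}(T)$, $0\le i,j\le m-1$. -}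

module Defs where

open import Data.Nat using (ℕ; zero; suc; _+_; _*_; _∸_; _^_; _≟_)
open import Data.Nat.ListAction using (sum)
import Data.Integer as ℤ
open import Data.Integer.Divisibility using () renaming (_∣_ to _∣ℤ_)
open import Data.Nat.Primality using (Prime)
open import Data.Fin using (Fin; toℕ)
open import Data.List using (List; []; _∷_; length; concatMap; reverse; map; allFin; upTo)
open import Data.Maybe using (Maybe; just; nothing)
open import Data.Bool using (if_then_else_)
open import Relation.Nullary.Decidable using (⌊_⌋)
open import Relation.Binary.PropositionalEquality using (_≡_)
import Data.Fin as F

Word : ℕ → Set
Word m = List (Fin m)

Morphism : ℕ → Set
Morphism m = Fin m → Word m

Uniform : (p m : ℕ) → Morphism m → Set
Uniform p m σ = ∀ a → length (σ a) ≡ p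

extend : ∀ {m} → Morphism m → Word m → Word m
extend σ = concatMap σ

iter : ∀ {m} → Morphism m → ℕ → Fin m → Word m
iter σ zero    a = a ∷ []
iter σ (suc n) a = extend σ (iter σ n a)

-- polynomials in 𝔽_p[T], represented by coefficient sequences with
-- natural-number coefficients; equality in 𝔽_p[T] is coefficientwise mod p,
-- i.e. p divides the (integer) difference of each pair of coefficients.
Poly : Set
Poly = ℕ → ℕ

_≈[_]_ : Poly → ℕ → Poly → Set
f ≈[ p ] g = ∀ k → ℤ.+ p ∣ℤ (ℤ.+ (f k) ℤ.- ℤ.+ (g k))

nth : ∀ {A : Set} → List A → ℕ → Maybe A
nth []       _       = nothing
nth (x ∷ _)  zero    = just x
nth (_ ∷ xs) (suc l) = nth xs l

-- P_W(T) = Σ_j w_{r-1-j} T^j : coefficient of T^j is the j-th letter of reverse W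
P : ∀ {m} → Word m → Poly
P W j with nth (reverse W) j
... | just a  = toℕ a
... | nothing = 0

β : ∀ {m} → Word m → Fin m → Poly
β W j l with nth (reverse W) l
... | just a  = if ⌊ a F.≟ j ⌋ then 1 else 0
... | nothing = 0

Mσ : ∀ {m} → Morphism m → Fin m → Fin m → Poly
Mσ σ i j = β (σ i) j

_·_ : Poly → Poly → Poly
(f · g) k = sum (map (λ i → f i * g (k ∸ i)) (upTo (suc k)))

subst-pow : Poly → ℕ → Poly
subst-pow f q k = sum (map (λ i → if ⌊ i * q ≟ k ⌋ then f i else 0) (upTo (suc k)))

R : ∀ {m} → Morphism m → ℕ → Fin m → Poly
R σ n i = P (iter σ n i)

matVecSubst : ∀ {m} → (Fin m → Fin m → Poly) → ℕ → (Fin m → Poly) → Fin m → Poly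
matVecSubst {m} M q v i k =
  sum (map (λ j → (subst-pow (M i j) q · v j) k) (allFin m))

{-# OPTIONS --safe #-}
-- Write q = p ^ n.  Every σ^n(a) has length q, so σ^(n+1)(i) = σ^n(a_0) ⋯ σ^n(a_(p-1))
-- for σ(i) = a_0 ⋯ a_(p-1), and the coefficient of T^(l q + r), r < q, in P_(σ^(n+1)(i))
-- is the coefficient of T^r in P_(σ^n(a)), where a is the l-th letter of σ(i) read
-- from the right.  On the other side, P_(σ^n(j)) has degree below q, so in
-- β_(σ(i),j)(T^q) · P_(σ^n(j)) that coefficient is [a = j] times the same number.
-- The identity therefore holds exactly over ℕ, not only modulo p.
module Submission where

open import Defs
open import Data.Nat using (ℕ; suc; _≥_; _^_)
open import Data.Nat.Primality using (Prime)
open import Data.Fin using (Fin)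

open import Data.Nat using (zero; _+_; _*_; _∸_; _≤_; _<_; _≟_; _≤?_; z≤n; s≤s; NonZero)
open import Data.Nat.Properties
open import Data.Nat.DivMod using (_%_; _/_; m≡m%n+[m/n]*n; m%n<n; [m+kn]%n≡m%n; m<n⇒m%n≡m)
open import Data.Nat.Divisibility using (_∣_; divides; _∣?_; _∣0)
open import Data.Nat.ListAction using (sum)
open import Data.Nat.Primality using (prime⇒nonZero)
import Data.Integer as ℤ
import Data.Integer.Properties as ℤ
open import Data.Fin using (toℕ)
import Data.Fin as F
import Data.Fin.Properties as F
open import Data.List
  using (List; []; _∷_; _++_; length; concatMap; reverse; map; allFin; upTo; applyUpTo; tabulate; [_])
open import Data.List.Properties
  using ( map-applyUpTo; map-tabulate; map-cong; reverse-++; unfold-reverse; ++-identityʳ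
        ; concatMap-++; concatMap-pure; length-reverse; length-++ )
open import Data.List.Relation.Unary.All using (All; []; _∷_; universal)
open import Data.List.Relation.Unary.All.Properties using (map⁺; applyUpTo⁺₁; tabulate⁺)
open import Data.Maybe using (Maybe; just; nothing; maybe′; _>>=_)
open import Data.Bool using (if_then_else_)
open import Data.Empty using (⊥-elim)
open import Function using (_∘_; id)
open import Relation.Nullary using (yes; no; ¬_)
open import Relation.Nullary.Decidable using (⌊_⌋)
open import Relation.Binary.Definitions using (DecidableEquality)
open import Relation.Binary.PropositionalEquality
  using (_≡_; _≢_; refl; sym; trans; cong; cong₂; _≗_; module ≡-Reasoning)

open ≡-Reasoning

sum-zero : ∀ {ns} → All (_≡ 0) ns → sum ns ≡ 0
sum-zero []           = refl
sum-zero (refl ∷ zs) = sum-zero zs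

sum-applyUpTo-single : ∀ N (h : ℕ → ℕ) {t} → t < N → (∀ {i} → i < N → i ≢ t → h i ≡ 0) →
                       sum (applyUpTo h N) ≡ h t
sum-applyUpTo-single (suc N) h {zero} _ vanish = begin
  h 0 + sum (applyUpTo (h ∘ suc) N)
    ≡⟨ cong (h 0 +_) (sum-zero (applyUpTo⁺₁ (h ∘ suc) N (λ i<N → vanish (s≤s i<N) λ ()))) ⟩
  h 0 + 0 ≡⟨ +-identityʳ (h 0) ⟩
  h 0     ∎
sum-applyUpTo-single (suc N) h {suc t} (s≤s t<N) vanish =
  cong₂ _+_ (vanish (s≤s z≤n) λ ())
            (sum-applyUpTo-single N (h ∘ suc) t<N λ i<N i≢t → vanish (s≤s i<N) (i≢t ∘ suc-injective))

sum-map-upTo-single : ∀ N (h : ℕ → ℕ) {t} → t < N → (∀ {i} → i < N → i ≢ t → h i ≡ 0) →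
                      sum (map h (upTo N)) ≡ h t
sum-map-upTo-single N h t<N vanish =
  trans (cong sum (map-applyUpTo id h N)) (sum-applyUpTo-single N h t<N vanish)

sum-tabulate-single : ∀ {m} (h : Fin m → ℕ) t → (∀ {j} → j ≢ t → h j ≡ 0) → sum (tabulate h) ≡ h t
sum-tabulate-single h F.zero vanish = begin
  h F.zero + sum (tabulate (h ∘ F.suc))
    ≡⟨ cong (h F.zero +_) (sum-zero (tabulate⁺ λ j → vanish {F.suc j} λ ())) ⟩
  h F.zero + 0 ≡⟨ +-identityʳ (h F.zero) ⟩
  h F.zero     ∎
sum-tabulate-single h (F.suc t) vanish =
  cong₂ _+_ (vanish λ ()) (sum-tabulate-single (h ∘ F.suc) t λ j≢t → vanish (j≢t ∘ F.suc-injective))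

sum-map-allFin-single : ∀ {m} (h : Fin m → ℕ) t → (∀ {j} → j ≢ t → h j ≡ 0) →
                        sum (map h (allFin m)) ≡ h t
sum-map-allFin-single h t vanish =
  trans (cong sum (map-tabulate id h)) (sum-tabulate-single h t vanish)

if-≟-true : ∀ {A : Set} (_≟ᴬ_ : DecidableEquality A) {x y} (a : ℕ) → x ≡ y →
            (if ⌊ x ≟ᴬ y ⌋ then a else 0) ≡ a
if-≟-true _≟ᴬ_ {x} {y} a x≡y with x ≟ᴬ y
... | yes _   = refl
... | no x≢y = ⊥-elim (x≢y x≡y)

if-≟-false : ∀ {A : Set} (_≟ᴬ_ : DecidableEquality A) {x y} (a : ℕ) → x ≢ y →
             (if ⌊ x ≟ᴬ y ⌋ then a else 0) ≡ 0
if-≟-false _≟ᴬ_ {x} {y} a x≢y with x ≟ᴬ y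
... | yes x≡y = ⊥-elim (x≢y x≡y)
... | no _    = refl

∣-near-multiple : ∀ q .{{_ : NonZero q}} l {r i} → r < q → i ≤ l * q + r →
                  l * q + r ∸ i < q → q ∣ i → i ≡ l * q
∣-near-multiple q l {r} {i} r<q i≤k k∸i<q (divides l′ i≡l′q) = begin
  i                           ≡⟨ sym (m∸[m∸n]≡n i≤k) ⟩
  l * q + r ∸ (l * q + r ∸ i) ≡⟨ cong (l * q + r ∸_) k∸i≡r ⟩
  l * q + r ∸ r               ≡⟨ m+n∸n≡m (l * q) r ⟩
  l * q                       ∎
  where
  k∸i≡r : l * q + r ∸ i ≡ r
  k∸i≡r = begin
    l * q + r ∸ i                  ≡⟨ sym (m<n⇒m%n≡m k∸i<q) ⟩
    (l * q + r ∸ i) % q            ≡⟨ sym ([m+kn]%n≡m%n (l * q + r ∸ i) l′ q) ⟩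
    (l * q + r ∸ i + l′ * q) % q   ≡⟨ cong (λ x → (l * q + r ∸ i + x) % q) (sym i≡l′q) ⟩
    (l * q + r ∸ i + i) % q        ≡⟨ cong (_% q) (trans (m∸n+n≡m i≤k) (+-comm (l * q) r)) ⟩
    (r + l * q) % q                ≡⟨ [m+kn]%n≡m%n r l q ⟩
    r % q                          ≡⟨ m<n⇒m%n≡m r<q ⟩
    r                              ∎

subst-pow-multiple : ∀ (f : Poly) q .{{_ : NonZero q}} l → subst-pow f q (l * q) ≡ f l
subst-pow-multiple f q l =
  trans (sum-map-upTo-single (suc (l * q)) term (s≤s (m≤m*n l q))
          λ {i} _ i≢l → if-≟-false _≟_ (f i) (i≢l ∘ *-cancelʳ-≡ i l q))
        (if-≟-true _≟_ (f l) refl)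
  where
  term : ℕ → ℕ
  term i = if ⌊ i * q ≟ l * q ⌋ then f i else 0

subst-pow-nonmultiple : ∀ (f : Poly) {q k} → ¬ q ∣ k → subst-pow f q k ≡ 0
subst-pow-nonmultiple f {q} {k} q∤k =
  sum-zero (map⁺ (universal (λ i → if-≟-false _≟_ (f i) (q∤k ∘ divides i ∘ sym)) (upTo (suc k))))

-- Only the term i = l q of the convolution survives: other multiples of q are
-- either past l q + r or at distance ≥ q from it, where g vanishes.
·-subst-pow-coeff : ∀ (f g : Poly) q .{{_ : NonZero q}} → (∀ {t} → q ≤ t → g t ≡ 0) →
                    ∀ l {r} → r < q → (subst-pow f q · g) (l * q + r) ≡ f l * g r
·-subst-pow-coeff f g q g-vanish l {r} r<q =
  trans (sum-map-upTo-single (suc k) term (s≤s (m≤m+n (l * q) r)) off-lq)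
        (cong₂ _*_ (subst-pow-multiple f q l) (cong g (m+n∸m≡n (l * q) r)))
  where
  k : ℕ
  k = l * q + r
  term : ℕ → ℕ
  term i = subst-pow f q i * g (k ∸ i)
  off-lq : ∀ {i} → i < suc k → i ≢ l * q → term i ≡ 0
  off-lq {i} (s≤s i≤k) i≢lq with q ∣? i | q ≤? k ∸ i
  ... | no q∤i | _       = cong (_* g (k ∸ i)) (subst-pow-nonmultiple f q∤i)
  ... | yes _  | yes q≤ = trans (cong (subst-pow f q i *_) (g-vanish q≤)) (*-zeroʳ (subst-pow f q i))
  ... | yes q∣i | no q≰ = ⊥-elim (i≢lq (∣-near-multiple q l r<q i≤k (≰⇒> q≰) q∣i))

matVecSubst-coeff : ∀ {m} (M : Fin m → Fin m → Poly) q .{{_ : NonZero q}} (v : Fin m → Poly) →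
                    (∀ j {t} → q ≤ t → v j t ≡ 0) → ∀ i l {r} → r < q →
                    matVecSubst M q v i (l * q + r) ≡ sum (map (λ j → M i j l * v j r) (allFin m))
matVecSubst-coeff {m} M q v v-vanish i l r<q =
  cong sum (map-cong (λ j → ·-subst-pow-coeff (M i j) (v j) q (v-vanish j) l r<q) (allFin m))

≗-by-divMod : ∀ q .{{_ : NonZero q}} {f g : ℕ → ℕ} →
              (∀ l r → r < q → f (l * q + r) ≡ g (l * q + r)) → f ≗ g
≗-by-divMod q {f} {g} blocks k = begin
  f k                   ≡⟨ cong f k≡ ⟩
  f (k / q * q + k % q) ≡⟨ blocks (k / q) (k % q) (m%n<n k q) ⟩
  g (k / q * q + k % q) ≡⟨ cong g (sym k≡) ⟩
  g k                   ∎
  where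
  k≡ : k ≡ k / q * q + k % q
  k≡ = trans (m≡m%n+[m/n]*n k q) (+-comm (k % q) _)

≗⇒≈ : ∀ p {f g : Poly} → f ≗ g → f ≈[ p ] g
≗⇒≈ p {f} f≗g k rewrite sym (f≗g k) | ℤ.+-inverseʳ (ℤ.+ f k) = p ∣0

concatMap-concatMap : ∀ {A B C : Set} (f : A → List B) (g : B → List C) xs →
                      concatMap g (concatMap f xs) ≡ concatMap (concatMap g ∘ f) xs
concatMap-concatMap f g []       = refl
concatMap-concatMap f g (x ∷ xs) =
  trans (concatMap-++ g (f x) (concatMap f xs))
        (cong (concatMap g (f x) ++_) (concatMap-concatMap f g xs))

reverse-concatMap : ∀ {A B : Set} (f : A → List B) xs →
                    reverse (concatMap f xs) ≡ concatMap (reverse ∘ f) (reverse xs)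
reverse-concatMap f []       = refl
reverse-concatMap f (x ∷ xs) = begin
  reverse (f x ++ concatMap f xs)
    ≡⟨ reverse-++ (f x) (concatMap f xs) ⟩
  reverse (concatMap f xs) ++ reverse (f x)
    ≡⟨ cong₂ _++_ (reverse-concatMap f xs) (sym (++-identityʳ (reverse (f x)))) ⟩
  concatMap (reverse ∘ f) (reverse xs) ++ concatMap (reverse ∘ f) [ x ]
    ≡⟨ sym (concatMap-++ (reverse ∘ f) (reverse xs) [ x ]) ⟩
  concatMap (reverse ∘ f) (reverse xs ++ [ x ])
    ≡⟨ cong (concatMap (reverse ∘ f)) (sym (unfold-reverse x xs)) ⟩
  concatMap (reverse ∘ f) (reverse (x ∷ xs))
    ∎

length-concatMap : ∀ {A B : Set} (f : A → List B) {q} → (∀ a → length (f a) ≡ q) →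
                   ∀ xs → length (concatMap f xs) ≡ length xs * q
length-concatMap f f-len []       = refl
length-concatMap f f-len (x ∷ xs) =
  trans (length-++ (f x)) (cong₂ _+_ (f-len x) (length-concatMap f f-len xs))

iter-suc : ∀ {m} (σ : Morphism m) n a → iter σ (suc n) a ≡ concatMap (iter σ n) (σ a)
iter-suc σ zero    a = trans (++-identityʳ (σ a)) (sym (concatMap-pure (σ a)))
iter-suc σ (suc n) a =
  trans (cong (concatMap σ) (iter-suc σ n a)) (concatMap-concatMap (iter σ n) σ (σ a))

length-iter : ∀ {p m} (σ : Morphism m) → Uniform p m σ → ∀ n a → length (iter σ n a) ≡ p ^ n
length-iter σ uniform zero    a = refl
length-iter {p} σ uniform (suc n) a = begin
  length (iter σ (suc n) a)               ≡⟨ cong length (iter-suc σ n a) ⟩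
  length (concatMap (iter σ n) (σ a))     ≡⟨ length-concatMap (iter σ n) (length-iter σ uniform n) (σ a) ⟩
  length (σ a) * p ^ n                    ≡⟨ cong (_* p ^ n) (uniform a) ⟩
  p * p ^ n                               ∎

nth-++ˡ : ∀ {A : Set} (xs ys : List A) {r} → r < length xs → nth (xs ++ ys) r ≡ nth xs r
nth-++ˡ (x ∷ xs) ys {zero}  _          = refl
nth-++ˡ (x ∷ xs) ys {suc r} (s≤s r<n) = nth-++ˡ xs ys r<n

nth-++ʳ : ∀ {A : Set} (xs ys : List A) t → nth (xs ++ ys) (length xs + t) ≡ nth ys t
nth-++ʳ []       ys t = refl
nth-++ʳ (x ∷ xs) ys t = nth-++ʳ xs ys t

nth-length≤ : ∀ {A : Set} (xs : List A) {t} → length xs ≤ t → nth xs t ≡ nothing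
nth-length≤ []       _          = refl
nth-length≤ (x ∷ xs) (s≤s n≤t) = nth-length≤ xs n≤t

nth-concatMap : ∀ {A B : Set} (f : A → List B) {q} → (∀ a → length (f a) ≡ q) →
                ∀ xs l {r} → r < q →
                nth (concatMap f xs) (l * q + r) ≡ (nth xs l >>= λ a → nth (f a) r)
nth-concatMap f f-len []       l       r<q = refl
nth-concatMap f f-len (x ∷ xs) zero    r<q =
  nth-++ˡ (f x) (concatMap f xs) (≤-trans r<q (≤-reflexive (sym (f-len x))))
nth-concatMap f {q} f-len (x ∷ xs) (suc l) {r} r<q = begin
  nth (f x ++ concatMap f xs) (q + l * q + r)             ≡⟨ cong (nth (f x ++ concatMap f xs)) shift ⟩
  nth (f x ++ concatMap f xs) (length (f x) + (l * q + r)) ≡⟨ nth-++ʳ (f x) (concatMap f xs) (l * q + r) ⟩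
  nth (concatMap f xs) (l * q + r)                         ≡⟨ nth-concatMap f f-len xs l r<q ⟩
  (nth xs l >>= λ a → nth (f a) r)                         ∎
  where
  shift : q + l * q + r ≡ length (f x) + (l * q + r)
  shift = trans (+-assoc q (l * q) r) (cong (_+ (l * q + r)) (sym (f-len x)))

P-nth : ∀ {m} (W : Word m) j → P W j ≡ maybe′ toℕ 0 (nth (reverse W) j)
P-nth W j with nth (reverse W) j
... | just a  = refl
... | nothing = refl

P-length≤ : ∀ {m} (W : Word m) {t} → length W ≤ t → P W t ≡ 0
P-length≤ W {t} len≤t =
  trans (P-nth W t)
        (cong (maybe′ toℕ 0) (nth-length≤ (reverse W) (≤-trans (≤-reflexive (length-reverse W)) len≤t)))

P-concatMap : ∀ {m} (f : Fin m → Word m) {q} → (∀ a → length (f a) ≡ q) →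
              ∀ w l {r} → r < q →
              P (concatMap f w) (l * q + r) ≡ maybe′ (λ a → P (f a) r) 0 (nth (reverse w) l)
P-concatMap f {q} f-len w l {r} r<q = begin
  P (concatMap f w) (l * q + r)
    ≡⟨ P-nth (concatMap f w) (l * q + r) ⟩
  maybe′ toℕ 0 (nth (reverse (concatMap f w)) (l * q + r))
    ≡⟨ cong (λ xs → maybe′ toℕ 0 (nth xs (l * q + r))) (reverse-concatMap f w) ⟩
  maybe′ toℕ 0 (nth (concatMap (reverse ∘ f) (reverse w)) (l * q + r))
    ≡⟨ cong (maybe′ toℕ 0) (nth-concatMap (reverse ∘ f) rev-len (reverse w) l r<q) ⟩
  maybe′ toℕ 0 (nth (reverse w) l >>= λ a → nth (reverse (f a)) r)
    ≡⟨ letter-coeff (nth (reverse w) l) ⟩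
  maybe′ (λ a → P (f a) r) 0 (nth (reverse w) l) ∎
  where
  rev-len : ∀ a → length (reverse (f a)) ≡ q
  rev-len a = trans (length-reverse (f a)) (f-len a)
  letter-coeff : ∀ mx → maybe′ toℕ 0 (mx >>= λ a → nth (reverse (f a)) r) ≡ maybe′ (λ a → P (f a) r) 0 mx
  letter-coeff (just a) = sym (P-nth (f a) r)
  letter-coeff nothing  = refl

indicator : ∀ {m} → Maybe (Fin m) → Fin m → ℕ
indicator mx j = maybe′ (λ a → if ⌊ a F.≟ j ⌋ then 1 else 0) 0 mx

β-nth : ∀ {m} (W : Word m) j l → β W j l ≡ indicator (nth (reverse W) l) j
β-nth W j l with nth (reverse W) l
... | just a  = refl
... | nothing = refl

sum-indicator : ∀ {m} (mx : Maybe (Fin m)) (v : Fin m → ℕ) →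
                sum (map (λ j → indicator mx j * v j) (allFin m)) ≡ maybe′ v 0 mx
sum-indicator {m} nothing  v = sum-zero (map⁺ (universal (λ _ → refl) (allFin m)))
sum-indicator     (just a) v =
  trans (sum-map-allFin-single _ a λ {j} j≢a → cong (_* v j) (if-≟-false F._≟_ 1 (j≢a ∘ sym)))
        (trans (cong (_* v a) (if-≟-true F._≟_ {a} 1 refl)) (+-identityʳ (v a)))

sum-β : ∀ {m} (W : Word m) l (v : Fin m → ℕ) →
        sum (map (λ j → β W j l * v j) (allFin m)) ≡ maybe′ v 0 (nth (reverse W) l)
sum-β {m} W l v =
  trans (cong sum (map-cong (λ j → cong (_* v j) (β-nth W j l)) (allFin m)))
        (sum-indicator (nth (reverse W) l) v)

module _ {p m} .{{_ : NonZero p}} (σ : Morphism m) (uniform : Uniform p m σ) (n : ℕ) where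

  private instance
    p^n≢0 : NonZero (p ^ n)
    p^n≢0 = m^n≢0 p n

  R-suc-coeff : ∀ i l {r} → r < p ^ n →
                R σ (suc n) i (l * p ^ n + r) ≡ maybe′ (λ a → R σ n a r) 0 (nth (reverse (σ i)) l)
  R-suc-coeff i l {r} r<q =
    trans (cong (λ w → P w (l * p ^ n + r)) (iter-suc σ n i))
          (P-concatMap (iter σ n) (length-iter σ uniform n) (σ i) l r<q)

  R-length≤ : ∀ j {t} → p ^ n ≤ t → R σ n j t ≡ 0
  R-length≤ j q≤t = P-length≤ (iter σ n j) (≤-trans (≤-reflexive (length-iter σ uniform n j)) q≤t)

  matVecSubst-Mσ-coeff : ∀ i l {r} → r < p ^ n →
                         matVecSubst (Mσ σ) (p ^ n) (R σ n) i (l * p ^ n + r) ≡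
                         maybe′ (λ a → R σ n a r) 0 (nth (reverse (σ i)) l)
  matVecSubst-Mσ-coeff i l {r} r<q =
    trans (matVecSubst-coeff (Mσ σ) (p ^ n) (R σ n) R-length≤ i l r<q)
          (sum-β (σ i) l (λ a → R σ n a r))

  R-suc≗matVecSubst : ∀ i → R σ (suc n) i ≗ matVecSubst (Mσ σ) (p ^ n) (R σ n) i
  R-suc≗matVecSubst i = ≗-by-divMod (p ^ n) λ l r r<q →
    trans (R-suc-coeff i l r<q) (sym (matVecSubst-Mσ-coeff i l r<q))

lemma4p9 : (p m : ℕ) → Prime p → m ≥ 1 → (σ : Morphism m) → Uniform p m σ →
    (n : ℕ) → (i : Fin m) →
    R σ (suc n) i ≈[ p ] matVecSubst (Mσ σ) (p ^ n) (R σ n) i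
lemma4p9 p m p-prime _ σ uniform n i =
  ≗⇒≈ p (R-suc≗matVecSubst {{prime⇒nonZero p-prime}} σ uniform n i)
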